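{- Let $G \in \mathcal{C}$, let $S$ be a minimal separator of $G$, and let $D$ be a full component of $S$. Let $Z \subseteq D$ be an inclusion-wise minimal set such that $G[Z]$ is connected and $S \subseteq N(Z)$. Then $Z$ is a clique.
   Context: A hole is an induced cycle of length at least $4$. An extended $C_5$ is a six-vertex graph obtained from a five-vertex hole by adding a vertex adjacent to exactly one vertex or exactly two consecutive vertices of the hole. $\mathcal{C}$ is the class of graphs with no hole of length at least $6$ and no extended $C_5$ as an induced subgraph. $N(X)$ is the open neighborhood of $X$ (vertices outside $X$ with a neighbor in $X$). A set $S$ is a minimal separator if $G-S$ has at least two connected components $D$ with $N(D)=S$; such components are the full components of $S$. -}

module Defs where

open import Data.Nat using (ℕ; zero; suc; _≤_)
open import Data.Fin using (Fin; toℕ)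
open import Data.Fin.Subset using (Subset; _∈_; _∉_; _⊆_)
open import Data.Bool using (Bool; true; false)
open import Data.Product using (Σ; ∃; ∃-syntax; _×_; _,_)
open import Data.Sum using (_⊎_)
open import Relation.Binary.PropositionalEquality using (_≡_; _≢_)
open import Relation.Nullary using (¬_)
open import Function.Definitions using (Injective)
open import Function.Bundles using (_⇔_)

record Graph (n : ℕ) : Set where
  field
    adj    : Fin n → Fin n → Bool
    sym    : ∀ u v → adj u v ≡ adj v u
    irrefl : ∀ v → adj v v ≡ false

module _ {n : ℕ} (G : Graph n) where
  open Graph G

  E : Fin n → Fin n → Set
  E u v = adj u v ≡ true

  CycAdj : (k : ℕ) → Fin k → Fin k → Set
  CycAdj k i j =
      (suc (toℕ i) ≡ toℕ j) ⊎ (suc (toℕ j) ≡ toℕ i)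
    ⊎ ((toℕ i ≡ 0) × (suc (toℕ j) ≡ k)) ⊎ ((toℕ j ≡ 0) × (suc (toℕ i) ≡ k))

  IsInducedCycle : (k : ℕ) → (Fin k → Fin n) → Set
  IsInducedCycle k f = Injective _≡_ _≡_ f × (∀ i j → E (f i) (f j) ⇔ CycAdj k i j)

  HasLongHole : Set
  HasLongHole = Σ ℕ λ k → (6 ≤ k) × Σ (Fin k → Fin n) λ f → IsInducedCycle k f

  -- G contains an extended C5 as an induced subgraph: a 5-hole f and a vertex v
  -- outside it adjacent to exactly one hole vertex, or exactly two consecutive
  -- hole vertices (w.l.o.g., by rotating f, these are f 0 resp. f 0, f 1).
  HasExtendedC5 : Set
  HasExtendedC5 = Σ (Fin 5 → Fin n) λ f → IsInducedCycle 5 f × Σ (Fin n) λ v →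
      (∀ i → v ≢ f i)
    × ((∀ i → E v (f i) ⇔ (i ≡ Fin.zero))
       ⊎ (∀ i → E v (f i) ⇔ ((i ≡ Fin.zero) ⊎ (i ≡ Fin.suc Fin.zero))))

  InC : Set
  InC = ¬ HasLongHole × ¬ HasExtendedC5

  data Reach (X : Subset n) : Fin n → Fin n → Set where
    here : ∀ {u} → u ∈ X → Reach X u u
    step : ∀ {u w v} → u ∈ X → E u w → Reach X w v → Reach X u v

  Connected : Subset n → Set
  Connected X = (∃[ x ] x ∈ X) × (∀ {u v} → u ∈ X → v ∈ X → Reach X u v)

  InN : Subset n → Fin n → Set
  InN X v = v ∉ X × ∃[ u ] (u ∈ X × E u v)

  IsComponent : Subset n → Subset n → Set
  IsComponent S D =
      (∀ {v} → v ∈ D → v ∉ S)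
    × Connected D
    × (∀ {u w} → u ∈ D → w ∉ S → E u w → w ∈ D)

  IsFullComponent : Subset n → Subset n → Set
  IsFullComponent S D = IsComponent S D × (∀ v → (v ∈ S) ⇔ InN D v)

  IsMinimalSeparator : Subset n → Set
  IsMinimalSeparator S =
    Σ (Subset n) λ D₁ → Σ (Subset n) λ D₂ →
      D₁ ≢ D₂ × IsFullComponent S D₁ × IsFullComponent S D₂

  Admissible : Subset n → Subset n → Subset n → Set
  Admissible S D Z = Z ⊆ D × Connected Z × (∀ {v} → v ∈ S → InN Z v)

  MinimalAdmissible : Subset n → Subset n → Subset n → Set
  MinimalAdmissible S D Z =
    Admissible S D Z × (∀ Z′ → Z′ ⊆ Z → Admissible S D Z′ → Z′ ≡ Z)

  IsClique : Subset n → Set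
  IsClique X = ∀ {u v} → u ∈ X → v ∈ X → u ≢ v → E u v

-- Suppose x, y ∈ Z are distinct and nonadjacent. Then G[Z] has a vertex b that is neither a
-- cut vertex nor adjacent to all of Z: the start of a maximal path of G[Z] is not a cut vertex,
-- and if it is adjacent to all of Z then x is another non-cut vertex. By minimality of Z, the
-- set Z − b misses some s ∈ S, whose only neighbour in Z is therefore b, and N[b] ∩ Z misses
-- some t ∈ S. Take an induced path P in Z whose head alone sees s and whose end alone sees t; it
-- has at least three vertices, as t has no neighbour in N[b] ∩ Z. Let D′ be a full component of
-- S other than D. If s ≁ t, closing s P t through D′ gives a hole of length at least 6. If
-- s ∼ t, then s P t is a hole, of length at least 6 unless P has three vertices, and then a
-- neighbour of t in D′ sees t, maybe s, and nothing of P: an extended C5.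

module Submission where

open import Defs
open import Data.Nat using (ℕ; zero; suc; _+_; _≤_; s≤s; z≤n; _<?_)
open import Data.Nat.Properties using (suc-injective; ≤-trans; ≤-reflexive; ≮⇒≥; <⇒≱; +-suc; m≤m+n)
open import Data.Fin using (Fin; toℕ; _≟_; zero; suc)
open import Data.Fin.Properties using (any?; pigeonhole) renaming (<-irrefl to <ᶠ-irrefl)
open import Data.Fin.Subset using (Subset; _∈_; _∉_; _⊆_; _─_; _-_; _∩_; _∪_; ⁅_⁆)
open import Data.Fin.Subset.Properties
  using ( _∈?_; ⊆-antisym; x∈⁅x⁆; x∈⁅y⁆⇒x≡y; x∈p∩q⁺; x∈p∩q⁻; p∩q⊆p; x∈p∪q⁺; x∈p∪q⁻
        ; p─q⊆p; x∈p∧x≢y⇒x∈p-y)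
open import Data.Bool using (true)
import Data.Bool as Bool
open import Data.Vec using (tabulate; _∷_; here; there)
open import Data.Vec.Properties using (lookup∘tabulate; []=⇒lookup; lookup⇒[]=; ≡-dec)
open import Data.List using (List; []; _∷_; length; lookup; _++_)
open import Data.List.Properties using (length-++-≤ʳ)
open import Data.List.Relation.Unary.All as All using (All; []; _∷_)
open import Data.List.Relation.Unary.All.Properties using (++⁺; ¬Any⇒All¬)
open import Data.List.Relation.Unary.Any using (here; there)
open import Data.List.Relation.Unary.AllPairs using ([]; _∷_)
open import Data.List.Relation.Unary.Unique.Propositional using (Unique)
open import Data.List.Relation.Unary.Linked using (Linked; []; [-]; _∷_)
open import Data.List.Membership.Propositional using () renaming (_∈_ to _∈ˡ_)
open import Data.List.Membership.Propositional.Properties using (∈-lookup)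
import Data.List.Membership.DecPropositional as DecMembership
open import Data.Product using (∃-syntax; _×_; _,_; proj₁; proj₂)
open import Data.Sum using (_⊎_; inj₁; inj₂)
import Data.Sum as Sum
open import Data.Empty using (⊥; ⊥-elim)
open import Data.Unit using (⊤; tt)
open import Function using (_∘_; const)
open import Function.Bundles using (_⇔_; mk⇔; Equivalence)
open import Function.Definitions using (Injective)
open import Function.Properties.Equivalence using () renaming (sym to ⇔-sym; trans to ⇔-trans)
open import Relation.Binary.PropositionalEquality using (_≡_; _≢_; refl; sym; trans; cong; subst)
open import Relation.Nullary using (¬_; Dec; yes; no; ¬?; contradiction)
open import Relation.Nullary.Decidable using (_×-dec_; decidable-stable)
open import Relation.Unary using (Decidable)

module _ {A : Set} where

  OnlyHead : (A → Set) → List A → Set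
  OnlyHead B []       = ⊥
  OnlyHead B (x ∷ xs) = B x × All (¬_ ∘ B) xs

  OnlyLast : (A → Set) → List A → Set
  OnlyLast B []           = ⊥
  OnlyLast B (x ∷ [])     = B x
  OnlyLast B (x ∷ y ∷ ys) = ¬ B x × OnlyLast B (y ∷ ys)

  module _ {B : A → Set} where

    OnlyHead-lookup : ∀ {xs} → OnlyHead B xs → ∀ i → B (lookup xs i) ⇔ (toℕ i ≡ 0)
    OnlyHead-lookup {_ ∷ _}  (Bx , _)    zero    = mk⇔ (const refl) (const Bx)
    OnlyHead-lookup {_ ∷ xs} (_ , ¬Bxs) (suc i) =
      mk⇔ (λ B → contradiction B (All.lookup ¬Bxs (∈-lookup i))) λ ()

    OnlyLast-∷ : ∀ {x} xs → ¬ B x → OnlyLast B xs → OnlyLast B (x ∷ xs)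
    OnlyLast-∷ (_ ∷ _) ¬Bx last = ¬Bx , last

    OnlyLast-++ : ∀ xs {ys} → All (¬_ ∘ B) xs → OnlyLast B ys → OnlyLast B (xs ++ ys)
    OnlyLast-++ []       []           last = last
    OnlyLast-++ (x ∷ xs) (¬Bx ∷ ¬Bxs) last = OnlyLast-∷ (xs ++ _) ¬Bx (OnlyLast-++ xs ¬Bxs last)

    OnlyLast-lookup : ∀ xs → OnlyLast B xs → ∀ i → B (lookup xs i) ⇔ (suc (toℕ i) ≡ length xs)
    OnlyLast-lookup (_ ∷ [])     Bx         zero    = mk⇔ (const refl) (const Bx)
    OnlyLast-lookup (_ ∷ _ ∷ _)  (¬Bx , _)  zero    = mk⇔ (λ Bx → contradiction Bx ¬Bx) λ ()
    OnlyLast-lookup (_ ∷ y ∷ ys) (_ , last) (suc i) =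
      ⇔-trans (OnlyLast-lookup (y ∷ ys) last i) (mk⇔ (cong suc) suc-injective)

  Unique-lookup-injective : ∀ {xs : List A} → Unique xs → Injective _≡_ _≡_ (lookup xs)
  Unique-lookup-injective {_ ∷ _}  _           {zero}  {zero}  _  = refl
  Unique-lookup-injective {_ ∷ _}  (x∉xs ∷ _) {zero}  {suc j} eq = contradiction eq (All.lookup x∉xs (∈-lookup j))
  Unique-lookup-injective {_ ∷ _}  (x∉xs ∷ _) {suc i} {zero}  eq =
    contradiction (sym eq) (All.lookup x∉xs (∈-lookup i))
  Unique-lookup-injective {_ ∷ _}  (_ ∷ uniq)  {suc i} {suc j} eq = cong suc (Unique-lookup-injective uniq eq)

Unique-length : ∀ {n} {xs : List (Fin n)} → Unique xs → length xs ≤ n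
Unique-length {n} {xs} uniq with n <? length xs
... | no n≮len = ≮⇒≥ n≮len
... | yes n<len with i , j , i<j , eq ← pigeonhole n<len (lookup xs) =
  contradiction i<j (<ᶠ-irrefl (Unique-lookup-injective uniq eq))

x∈p─q⇒x∉q : ∀ {n} (p q : Subset n) {x} → x ∈ p ─ q → x ∉ q
x∈p─q⇒x∉q (_ ∷ p) (_ ∷ q) (there x∈p─q) (there x∈q) = x∈p─q⇒x∉q p q x∈p─q x∈q

x∈p-y⇒x≢y : ∀ {n} {p : Subset n} {x y} → x ∈ p - y → x ≢ y
x∈p-y⇒x≢y {p = p} {y = y} x∈p-y refl = x∈p─q⇒x∉q p ⁅ y ⁆ x∈p-y (x∈⁅x⁆ y)

Consecutive : ∀ {k} → Fin k → Fin k → Set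
Consecutive i j = suc (toℕ i) ≡ toℕ j ⊎ suc (toℕ j) ≡ toℕ i

Consecutive-sym⇔ : ∀ {k} {i j : Fin k} → Consecutive i j ⇔ Consecutive j i
Consecutive-sym⇔ = mk⇔ Sum.swap Sum.swap

Consecutive-zero-suc : ∀ {k} {j : Fin k} → Consecutive {suc k} zero (suc j) ⇔ (toℕ j ≡ 0)
Consecutive-zero-suc = mk⇔ (λ { (inj₁ eq) → sym (suc-injective eq) ; (inj₂ ()) }) (inj₁ ∘ cong suc ∘ sym)

Consecutive-suc-suc : ∀ {k} {i j : Fin k} → Consecutive (suc i) (suc j) ⇔ Consecutive i j
Consecutive-suc-suc = mk⇔ (Sum.map suc-injective suc-injective) (Sum.map (cong suc) (cong suc))

module _ {n : ℕ} (G : Graph n) where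
  open Graph G using (adj) renaming (sym to adj-sym; irrefl to adj-irrefl)

  infix 4 _~_
  _~_ : Fin n → Fin n → Set
  _~_ = E G

  E? : ∀ u v → Dec (u ~ v)
  E? u v = adj u v Bool.≟ true

  ~-sym : ∀ {u v} → u ~ v → v ~ u
  ~-sym {u} {v} u~v = trans (sym (adj-sym u v)) u~v

  ~-sym⇔ : ∀ {u v} → u ~ v ⇔ v ~ u
  ~-sym⇔ = mk⇔ ~-sym ~-sym

  ~-irrefl : ∀ {v} → ¬ v ~ v
  ~-irrefl {v} v~v with () ← trans (sym v~v) (adj-irrefl v)

  -- Neighbourhoods and connectivity

  neighbours : Fin n → Subset n
  neighbours u = tabulate (adj u)

  ∈-neighbours : ∀ {u v} → v ∈ neighbours u ⇔ u ~ v
  ∈-neighbours {u} {v} = mk⇔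
    (λ v∈ → trans (sym (lookup∘tabulate (adj u) v)) ([]=⇒lookup v∈))
    (λ u~v → lookup⇒[]= v _ (trans (lookup∘tabulate (adj u) v) u~v))

  N[_] : Fin n → Subset n
  N[ u ] = ⁅ u ⁆ ∪ neighbours u

  ∈-N[] : ∀ {u v} → v ∈ N[ u ] ⇔ (v ≡ u ⊎ u ~ v)
  ∈-N[] {u} = mk⇔
    (Sum.map (x∈⁅y⁆⇒x≡y u) (Equivalence.to ∈-neighbours) ∘ x∈p∪q⁻ ⁅ u ⁆ (neighbours u))
    (x∈p∪q⁺ ∘ Sum.map (λ { refl → x∈⁅x⁆ u }) (Equivalence.from ∈-neighbours))

  InN? : ∀ X v → Dec (InN G X v)
  InN? X v = ¬? (v ∈? X) ×-dec any? (λ u → (u ∈? X) ×-dec E? u v)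

  Reach-start : ∀ {X u v} → Reach G X u v → u ∈ X
  Reach-start (here u∈X)     = u∈X
  Reach-start (step u∈X _ _) = u∈X

  Reach-end : ∀ {X u v} → Reach G X u v → v ∈ X
  Reach-end (here v∈X)     = v∈X
  Reach-end (step _ _ reach) = Reach-end reach

  Reach-trans : ∀ {X u v w} → Reach G X u v → Reach G X v w → Reach G X u w
  Reach-trans (here _)           reach′ = reach′
  Reach-trans (step u∈X u~ reach) reach′ = step u∈X u~ (Reach-trans reach reach′)

  Reach-snoc : ∀ {X u v w} → Reach G X u v → v ~ w → w ∈ X → Reach G X u w
  Reach-snoc reach v~w w∈X = Reach-trans reach (step (Reach-end reach) v~w (here w∈X))

  Reach-sym : ∀ {X u v} → Reach G X u v → Reach G X v u
  Reach-sym (here u∈X)          = here u∈X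
  Reach-sym (step u∈X u~w reach) = Reach-snoc (Reach-sym reach) (~-sym u~w) u∈X

  Linked-Reach : ∀ {Y h vs w} → Linked _~_ (h ∷ vs) → All (_∈ Y) (h ∷ vs) → w ∈ˡ h ∷ vs → Reach G Y w h
  Linked-Reach _            (h∈Y ∷ _)     (here refl)  = here h∈Y
  Linked-Reach (h~v ∷ path) (h∈Y ∷ vs∈Y) (there w∈vs) = Reach-snoc (Linked-Reach path vs∈Y w∈vs) (~-sym h~v) h∈Y

  connected-by-hub : ∀ {Y h} → h ∈ Y → (∀ {w} → w ∈ Y → Reach G Y w h) → Connected G Y
  connected-by-hub h∈Y reach = (_ , h∈Y) , λ u∈Y v∈Y → Reach-trans (reach u∈Y) (Reach-sym (reach v∈Y))

  connected-by-universal : ∀ {Y h} → h ∈ Y → (∀ {w} → w ∈ Y → w ≢ h → w ~ h) → Connected G Y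
  connected-by-universal {Y} {h} h∈Y universal = connected-by-hub h∈Y reach
    where
      reach : ∀ {w} → w ∈ Y → Reach G Y w h
      reach {w} w∈Y with w ≟ h
      ... | yes refl = here w∈Y
      ... | no w≢h   = step w∈Y (universal w∈Y w≢h) (here h∈Y)

  ∩N[]-connected : ∀ {Y b} → b ∈ Y → Connected G (Y ∩ N[ b ])
  ∩N[]-connected {Y} {b} b∈Y =
    connected-by-universal (x∈p∩q⁺ (b∈Y , Equivalence.from ∈-N[] (inj₁ refl))) universal
    where
      universal : ∀ {w} → w ∈ Y ∩ N[ b ] → w ≢ b → w ~ b
      universal {w} w∈ w≢b with Equivalence.to ∈-N[] (proj₂ (x∈p∩q⁻ Y N[ b ] w∈))
      ... | inj₁ w≡b = contradiction w≡b w≢b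
      ... | inj₂ b~w = ~-sym b~w

  ∩N[]-proper : ∀ {Y b y} → y ∈ Y → y ≢ b → ¬ b ~ y → Y ∩ N[ b ] ≢ Y
  ∩N[]-proper {Y} {b} {y} y∈Y y≢b ¬b~y eq
    with Equivalence.to ∈-N[] (proj₂ (x∈p∩q⁻ Y N[ b ] (subst (y ∈_) (sym eq) y∈Y)))
  ... | inj₁ y≡b = y≢b y≡b
  ... | inj₂ b~y = ¬b~y b~y

  Reach-component : ∀ {S C₁ C₂ a v} → IsComponent G S C₁ → IsComponent G S C₂ →
    Reach G C₁ a v → a ∈ C₂ → v ∈ C₂
  Reach-component _                    _                   (here _)           a∈C₂ = a∈C₂
  Reach-component c₁@(C₁∩S=∅ , _ , _) c₂@(_ , _ , closed) (step _ a~w reach) a∈C₂ =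
    Reach-component c₁ c₂ reach (closed a∈C₂ (C₁∩S=∅ (Reach-start reach)) a~w)

  component-unique : ∀ {S C₁ C₂ w} → IsComponent G S C₁ → IsComponent G S C₂ →
    w ∈ C₁ → w ∈ C₂ → C₁ ≡ C₂
  component-unique c₁@(_ , (_ , reach₁) , _) c₂@(_ , (_ , reach₂) , _) w∈C₁ w∈C₂ = ⊆-antisym
    (λ v∈C₁ → Reach-component c₁ c₂ (reach₁ w∈C₁ v∈C₁) w∈C₂)
    (λ v∈C₂ → Reach-component c₂ c₁ (reach₂ w∈C₂ v∈C₂) w∈C₁)

  other-full-component : ∀ {S} → IsMinimalSeparator G S → ∀ D → ∃[ D′ ] IsFullComponent G S D′ × D′ ≢ D
  other-full-component (D₁ , D₂ , D₁≢D₂ , full₁ , full₂) D with ≡-dec Bool._≟_ D₁ D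
  ... | no D₁≢D  = D₁ , full₁ , D₁≢D
  ... | yes refl = D₂ , full₂ , D₁≢D₂ ∘ sym

  -- Non-cut vertices

  open DecMembership (_≟_ {n}) using () renaming (_∈?_ to _∈ˡ?_)

  record MaximalPath (Z : Subset n) : Set where
    constructor maximalPath
    field
      start next : Fin n
      rest       : List (Fin n)
      inZ        : All (_∈ Z) (start ∷ next ∷ rest)
      linked     : Linked _~_ (start ∷ next ∷ rest)
      unique     : Unique (start ∷ next ∷ rest)
      maximal    : ∀ {w} → w ∈ Z → start ~ w → w ∈ˡ start ∷ next ∷ rest

  -- k is fuel: a path has at most n vertices, so it cannot run out.
  extend-to-maximal-path : ∀ {Z} k v₀ v₁ vs → n ≤ k + length (v₀ ∷ v₁ ∷ vs) →
    All (_∈ Z) (v₀ ∷ v₁ ∷ vs) → Linked _~_ (v₀ ∷ v₁ ∷ vs) → Unique (v₀ ∷ v₁ ∷ vs) →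
    MaximalPath Z
  extend-to-maximal-path {Z} k v₀ v₁ vs bound inZ linked uniq
    with any? (λ w → (w ∈? Z) ×-dec E? v₀ w ×-dec ¬? (w ∈ˡ? v₀ ∷ v₁ ∷ vs))
  ... | no none = maximalPath v₀ v₁ vs inZ linked uniq maximal
    where
      maximal : ∀ {w} → w ∈ Z → v₀ ~ w → w ∈ˡ v₀ ∷ v₁ ∷ vs
      maximal {w} w∈Z v₀~w = decidable-stable (w ∈ˡ? _) (λ w∉ → none (w , w∈Z , v₀~w , w∉))
  ... | yes (w , w∈Z , v₀~w , w∉) with uniq′ ← ¬Any⇒All¬ _ w∉ ∷ uniq with k
  ...   | zero  = contradiction (Unique-length uniq′) (<⇒≱ (s≤s bound))
  ...   | suc k = extend-to-maximal-path k w v₀ (v₁ ∷ vs) (≤-trans bound (≤-reflexive (sym (+-suc k _))))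
                    (w∈Z ∷ inZ) (~-sym v₀~w ∷ linked) uniq′

  maximal-path : ∀ {Z x y} → Connected G Z → x ∈ Z → y ∈ Z → x ≢ y → MaximalPath Z
  maximal-path {x = x} (_ , reach) x∈Z y∈Z x≢y with reach x∈Z y∈Z
  ... | here _ = contradiction refl x≢y
  ... | step {w = w} _ x~w w⇝y = extend-to-maximal-path n w x [] (m≤m+n n 2)
          (Reach-start w⇝y ∷ x∈Z ∷ []) (~-sym x~w ∷ [-]) ((w≢x ∷ []) ∷ [] ∷ [])
    where
      w≢x : w ≢ x
      w≢x refl = ~-irrefl x~w

  maximal-path-start-not-cut : ∀ {Z} → Connected G Z → (P : MaximalPath Z) → Connected G (Z - MaximalPath.start P)
  maximal-path-start-not-cut {Z} (_ , reach)
    (maximalPath v₀ v₁ vs (_ ∷ rest⊆Z) (_ ∷ linked) (v₀∉rest ∷ _) maximal) =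
    connected-by-hub (All.head rest⊆Z-v₀)
      (λ w∈ → avoid-v₀ (reach (p─q⊆p Z ⁅ v₀ ⁆ w∈) (All.head rest⊆Z)) (x∈p-y⇒x≢y w∈))
    where
      rest⊆Z-v₀ : All (_∈ Z - v₀) (v₁ ∷ vs)
      rest⊆Z-v₀ = All.zipWith (λ (w∈Z , v₀≢w) → x∈p∧x≢y⇒x∈p-y w∈Z (v₀≢w ∘ sym))
                              (rest⊆Z , v₀∉rest)

      avoid-v₀ : ∀ {w} → Reach G Z w v₁ → w ≢ v₀ → Reach G (Z - v₀) w v₁
      avoid-v₀ (here w∈Z) w≢v₀ = here (x∈p∧x≢y⇒x∈p-y w∈Z w≢v₀)
      avoid-v₀ (step {w = u} w∈Z w~u u⇝v₁) w≢v₀ with u ≟ v₀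
      ... | no u≢v₀ = step (x∈p∧x≢y⇒x∈p-y w∈Z w≢v₀) w~u (avoid-v₀ u⇝v₁ u≢v₀)
      ... | yes refl with maximal w∈Z (~-sym w~u)
      ...   | here w≡v₀     = contradiction w≡v₀ w≢v₀
      ...   | there w∈rest = Linked-Reach linked rest⊆Z-v₀ w∈rest

  non-cut-vertex : ∀ {Z x y} → Connected G Z → x ∈ Z → y ∈ Z → x ≢ y → ∃[ b ] b ∈ Z × Connected G (Z - b)
  non-cut-vertex conn x∈Z y∈Z x≢y with P ← maximal-path conn x∈Z y∈Z x≢y =
    MaximalPath.start P , All.head (MaximalPath.inZ P) , maximal-path-start-not-cut conn P

  non-cut-non-universal-vertex : ∀ {Z x y} → Connected G Z → x ∈ Z → y ∈ Z → x ≢ y → ¬ x ~ y →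
    ∃[ b ] b ∈ Z × Connected G (Z - b) × ∃[ y′ ] y′ ∈ Z × y′ ≢ b × ¬ b ~ y′
  non-cut-non-universal-vertex {Z} {x} {y} conn x∈Z y∈Z x≢y ¬x~y
    with b , b∈Z , Z-b-conn ← non-cut-vertex conn x∈Z y∈Z x≢y
    with any? (λ y′ → (y′ ∈? Z) ×-dec ¬? (y′ ≟ b) ×-dec ¬? (E? b y′))
  ... | yes (y′ , y′∈Z , y′≢b , ¬b~y′) = b , b∈Z , Z-b-conn , y′ , y′∈Z , y′≢b , ¬b~y′
  ... | no none = x , x∈Z , Z-x-conn , y , y∈Z , x≢y ∘ sym , ¬x~y
    where
      universal : ∀ {w} → w ∈ Z → w ≢ b → b ~ w
      universal {w} w∈Z w≢b = decidable-stable (E? b w) (λ ¬b~w → none (w , w∈Z , w≢b , ¬b~w))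

      b≢x : b ≢ x
      b≢x refl = ¬x~y (universal y∈Z (x≢y ∘ sym))

      Z-x-conn : Connected G (Z - x)
      Z-x-conn = connected-by-universal (x∈p∧x≢y⇒x∈p-y b∈Z b≢x)
        (λ w∈ w≢b → ~-sym (universal (p─q⊆p Z ⁅ x ⁆ w∈) w≢b))

  -- Induced paths and holes

  SeesOnlyHead : Fin n → List (Fin n) → Set
  SeesOnlyHead x []         = ⊤
  SeesOnlyHead x vs@(_ ∷ _) = OnlyHead (x ~_) vs

  SeesOnlyEnds : Fin n → List (Fin n) → Set
  SeesOnlyEnds x []       = ⊥
  SeesOnlyEnds x (v ∷ vs) = x ~ v × OnlyLast (x ~_) vs

  data InducedPath : List (Fin n) → Set where
    []   : InducedPath []
    cons : ∀ {x xs} → SeesOnlyHead x xs → All (x ≢_) xs → InducedPath xs → InducedPath (x ∷ xs)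

  InducedPathIn : Subset n → List (Fin n) → Set
  InducedPathIn X vs = InducedPath vs × All (_∈ X) vs

  InducedPath⇒Unique : ∀ {vs} → InducedPath vs → Unique vs
  InducedPath⇒Unique []                = []
  InducedPath⇒Unique (cons _ x∉xs path) = x∉xs ∷ InducedPath⇒Unique path

  InducedPath-adjacent : ∀ {vs} → InducedPath vs → ∀ i j → lookup vs i ~ lookup vs j ⇔ Consecutive i j
  InducedPath-adjacent (cons _ _ _) zero zero =
    mk⇔ (λ v~v → contradiction v~v ~-irrefl) λ { (inj₁ ()) ; (inj₂ ()) }
  InducedPath-adjacent {_ ∷ _ ∷ _} (cons first _ _) zero (suc j) =
    ⇔-trans (OnlyHead-lookup first j) (⇔-sym Consecutive-zero-suc)
  InducedPath-adjacent {_ ∷ _ ∷ _} (cons first _ _) (suc i) zero =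
    ⇔-trans ~-sym⇔ (⇔-trans (OnlyHead-lookup first i) (⇔-sym (⇔-trans Consecutive-sym⇔ Consecutive-zero-suc)))
  InducedPath-adjacent (cons _ _ path) (suc i) (suc j) =
    ⇔-trans (InducedPath-adjacent path i j) (⇔-sym Consecutive-suc-suc)

  InducedPath-++ : ∀ {P Q : Fin n → Set} {t ps rs} →
    InducedPath ps → All P ps → OnlyLast (t ~_) ps → All (_≢ t) ps →
    InducedPath (t ∷ rs) → All Q rs → (∀ {a c} → P a → Q c → ¬ a ~ c × a ≢ c) →
    InducedPath (ps ++ t ∷ rs)
  InducedPath-++ {ps = _ ∷ []} _ (Pp ∷ []) t~p (p≢t ∷ []) path′ Qrs apart =
    cons (~-sym t~p , All.map (proj₁ ∘ apart Pp) Qrs) (p≢t ∷ All.map (proj₂ ∘ apart Pp) Qrs) path′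
  InducedPath-++ {ps = _ ∷ _ ∷ _} (cons (p~q , ¬p~qs) p∉qs path) (Pp ∷ Pqs) (¬t~p , last) (p≢t ∷ qs≢t)
                 path′ Qrs apart =
    cons (p~q , ++⁺ ¬p~qs ((¬t~p ∘ ~-sym) ∷ All.map (proj₁ ∘ apart Pp) Qrs))
         (++⁺ p∉qs (p≢t ∷ All.map (proj₂ ∘ apart Pp) Qrs))
         (InducedPath-++ path Pqs last qs≢t path′ Qrs apart)

  -- A walk in X is shortcut into an induced path ending at its first B-vertex; the suffix of
  -- that path from its last A-vertex meets A only at its head and B only at its end.
  module _ {X : Subset n} {A B : Fin n → Set} (A? : Decidable A) (B? : Decidable B) where

    private
      PathToB : Fin n → Set
      PathToB u = ∃[ vs ] InducedPathIn X (u ∷ vs) × OnlyLast B (u ∷ vs)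

      Avoids : Fin n → List (Fin n) → Set
      Avoids u = All (λ z → ¬ u ~ z × u ≢ z)

      attach : ∀ {u} y ys → InducedPathIn X (y ∷ ys) → OnlyLast B (y ∷ ys) → u ∈ X → ¬ B u →
        Avoids u ys → Avoids u (y ∷ ys) ⊎ PathToB u
      attach {u} y ys path@(ip , _) last u∈X ¬Bu avoids with u ≟ y
      ... | yes refl = inj₂ (ys , path , last)
      ... | no u≢y with E? u y
      ...   | no ¬u~y = inj₁ ((¬u~y , u≢y) ∷ avoids)
      ...   | yes u~y =
        inj₂ (y ∷ ys , (cons (u~y , All.map proj₁ avoids) (u≢y ∷ All.map proj₂ avoids) ip , u∈X ∷ proj₂ path)
             , ¬Bu , last)

      shortcut : ∀ {u} y ys → InducedPathIn X (y ∷ ys) → OnlyLast B (y ∷ ys) → u ∈ X → ¬ B u →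
        Avoids u (y ∷ ys) ⊎ PathToB u
      shortcut y [] path last u∈X ¬Bu = attach y [] path last u∈X ¬Bu []
      shortcut y (z ∷ zs) path@(cons _ _ ip , _ ∷ zs∈X) last@(_ , last′) u∈X ¬Bu
        with shortcut z zs (ip , zs∈X) last′ u∈X ¬Bu
      ... | inj₂ found  = inj₂ found
      ... | inj₁ avoids = attach y (z ∷ zs) path last u∈X ¬Bu avoids

      path-to-B : ∀ {u v} → Reach G X u v → B v → PathToB u
      path-to-B (here u∈X) Bv = [] , (cons tt [] [] , u∈X ∷ []) , Bv
      path-to-B {u} (step u∈X u~w reach) Bv with B? u
      ... | yes Bu = [] , (cons tt [] [] , u∈X ∷ []) , Bu
      ... | no ¬Bu with vs , path , last ← path-to-B reach Bv with shortcut _ vs path last u∈X ¬Bu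
      ...   | inj₂ found             = found
      ...   | inj₁ ((¬u~w , _) ∷ _) = contradiction u~w ¬u~w

      PathFromAToB : Set
      PathFromAToB = ∃[ vs ] InducedPathIn X vs × OnlyHead A vs × OnlyLast B vs

      consider : ∀ y ys → InducedPathIn X (y ∷ ys) → OnlyLast B (y ∷ ys) → All (¬_ ∘ A) ys →
        All (¬_ ∘ A) (y ∷ ys) ⊎ PathFromAToB
      consider y ys path last ¬Ays with A? y
      ... | yes Ay = inj₂ (y ∷ ys , path , (Ay , ¬Ays) , last)
      ... | no ¬Ay = inj₁ (¬Ay ∷ ¬Ays)

      from-last-A : ∀ y ys → InducedPathIn X (y ∷ ys) → OnlyLast B (y ∷ ys) →
        All (¬_ ∘ A) (y ∷ ys) ⊎ PathFromAToB
      from-last-A y [] path last = consider y [] path last []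
      from-last-A y (z ∷ zs) path@(cons _ _ ip , _ ∷ zs∈X) last@(_ , last′) with from-last-A z zs (ip , zs∈X) last′
      ... | inj₂ found = inj₂ found
      ... | inj₁ ¬Azs  = consider y (z ∷ zs) path last ¬Azs

    induced-path : ∀ {u v} → A u → B v → Reach G X u v →
      ∃[ vs ] InducedPathIn X vs × OnlyHead A vs × OnlyLast B vs
    induced-path {u} Au Bv reach with vs , path , last ← path-to-B reach Bv with from-last-A u vs path last
    ... | inj₂ found      = found
    ... | inj₁ (¬Au ∷ _) = contradiction Au ¬Au

  CycAdj-sym : ∀ {k} {i j : Fin k} → CycAdj G k i j → CycAdj G k j i
  CycAdj-sym (inj₁ i→j)                 = inj₂ (inj₁ i→j)
  CycAdj-sym (inj₂ (inj₁ j→i))          = inj₁ j→i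
  CycAdj-sym (inj₂ (inj₂ (inj₁ wrap))) = inj₂ (inj₂ (inj₂ wrap))
  CycAdj-sym (inj₂ (inj₂ (inj₂ wrap))) = inj₂ (inj₂ (inj₁ wrap))

  ¬CycAdj-zero-zero : ∀ {m} → ¬ CycAdj G (suc (suc m)) zero zero
  ¬CycAdj-zero-zero (inj₁ ())
  ¬CycAdj-zero-zero (inj₂ (inj₁ ()))
  ¬CycAdj-zero-zero (inj₂ (inj₂ (inj₁ (_ , ()))))
  ¬CycAdj-zero-zero (inj₂ (inj₂ (inj₂ (_ , ()))))

  CycAdj-zero-suc : ∀ {m} {j : Fin m} → CycAdj G (suc m) zero (suc j) ⇔ (toℕ j ≡ 0 ⊎ suc (toℕ j) ≡ m)
  CycAdj-zero-suc = mk⇔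
    (λ { (inj₁ eq)                        → inj₁ (sym (suc-injective eq))
       ; (inj₂ (inj₂ (inj₁ (_ , wrap)))) → inj₂ (suc-injective wrap)
       ; (inj₂ (inj₁ ()))
       ; (inj₂ (inj₂ (inj₂ (() , _))))
       })
    Sum.[ inj₁ ∘ cong suc ∘ sym , (λ wrap → inj₂ (inj₂ (inj₁ (refl , cong suc wrap)))) ]

  CycAdj-suc-suc : ∀ {m} {i j : Fin m} → CycAdj G (suc m) (suc i) (suc j) ⇔ Consecutive i j
  CycAdj-suc-suc = mk⇔
    (λ { (inj₁ eq)                     → inj₁ (suc-injective eq)
       ; (inj₂ (inj₁ eq))              → inj₂ (suc-injective eq)
       ; (inj₂ (inj₂ (inj₁ (() , _))))
       ; (inj₂ (inj₂ (inj₂ (() , _))))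
       })
    Sum.[ inj₁ ∘ cong suc , inj₂ ∘ inj₁ ∘ cong suc ]

  CycAdj-suc-zero : ∀ {m} {i : Fin m} → CycAdj G (suc m) (suc i) zero ⇔ (toℕ i ≡ 0 ⊎ suc (toℕ i) ≡ m)
  CycAdj-suc-zero = mk⇔ (Equivalence.to CycAdj-zero-suc ∘ CycAdj-sym) (CycAdj-sym ∘ Equivalence.from CycAdj-zero-suc)

  SeesOnlyEnds-lookup : ∀ {x vs} → SeesOnlyEnds x vs →
    ∀ j → x ~ lookup vs j ⇔ (toℕ j ≡ 0 ⊎ suc (toℕ j) ≡ length vs)
  SeesOnlyEnds-lookup {vs = _ ∷ _}  (x~v , _)  zero    = mk⇔ (const (inj₁ refl)) (const x~v)
  SeesOnlyEnds-lookup {vs = _ ∷ vs} (_ , last) (suc j) =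
    ⇔-trans (OnlyLast-lookup vs last j) (mk⇔ (inj₂ ∘ cong suc) λ { (inj₁ ()) ; (inj₂ eq) → suc-injective eq })

  induced-cycle : ∀ {x} vs → InducedPath vs → All (x ≢_) vs → SeesOnlyEnds x vs →
    IsInducedCycle G (suc (length vs)) (lookup (x ∷ vs))
  induced-cycle (_ ∷ []) _ _ (_ , ())
  induced-cycle {x} vs@(_ ∷ _ ∷ _) path x∉vs ends =
    Unique-lookup-injective (x∉vs ∷ InducedPath⇒Unique path) , adjacent
    where
      adjacent : ∀ i j → lookup (x ∷ vs) i ~ lookup (x ∷ vs) j ⇔ CycAdj G (suc (length vs)) i j
      adjacent zero    zero    = mk⇔ (λ x~x → contradiction x~x ~-irrefl) (λ adj → contradiction adj ¬CycAdj-zero-zero)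
      adjacent zero    (suc j) = ⇔-trans (SeesOnlyEnds-lookup ends j) (⇔-sym CycAdj-zero-suc)
      adjacent (suc i) zero    = ⇔-trans ~-sym⇔ (⇔-trans (SeesOnlyEnds-lookup ends i) (⇔-sym CycAdj-suc-zero))
      adjacent (suc i) (suc j) = ⇔-trans (InducedPath-adjacent path i j) (⇔-sym CycAdj-suc-suc)

  long-hole : ∀ {x} vs → InducedPath vs → All (x ≢_) vs → SeesOnlyEnds x vs → 5 ≤ length vs → HasLongHole G
  long-hole vs path x∉vs ends 5≤ = suc (length vs) , s≤s 5≤ , _ , induced-cycle vs path x∉vs ends

  extended-C5 : ∀ {q a b c d e} → IsInducedCycle G 5 (lookup (a ∷ b ∷ c ∷ d ∷ e ∷ [])) →
    All (q ≢_) (a ∷ b ∷ c ∷ d ∷ e ∷ []) → q ~ a → ¬ q ~ c → ¬ q ~ d → ¬ q ~ e → HasExtendedC5 G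
  extended-C5 {q} {a} {b} {c} {d} {e} hole q∉hole q~a ¬q~c ¬q~d ¬q~e =
    _ , hole , q , (λ i → All.lookup q∉hole (∈-lookup i)) , attachment (E? q b)
    where
      f : Fin 5 → Fin n
      f = lookup (a ∷ b ∷ c ∷ d ∷ e ∷ [])
      attachment : Dec (q ~ b) →
        (∀ i → q ~ f i ⇔ (i ≡ zero)) ⊎ (∀ i → q ~ f i ⇔ (i ≡ zero ⊎ i ≡ suc zero))
      attachment (no ¬q~b) = inj₁ λ
        { zero → mk⇔ (const refl) (const q~a)
        ; (suc zero) → mk⇔ (λ q~ → contradiction q~ ¬q~b) λ ()
        ; (suc (suc zero)) → mk⇔ (λ q~ → contradiction q~ ¬q~c) λ ()
        ; (suc (suc (suc zero))) → mk⇔ (λ q~ → contradiction q~ ¬q~d) λ ()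
        ; (suc (suc (suc (suc zero)))) → mk⇔ (λ q~ → contradiction q~ ¬q~e) λ ()
        }
      attachment (yes q~b) = inj₂ λ
        { zero → mk⇔ (const (inj₁ refl)) (const q~a)
        ; (suc zero) → mk⇔ (const (inj₂ refl)) (const q~b)
        ; (suc (suc zero)) → mk⇔ (λ q~ → contradiction q~ ¬q~c) λ { (inj₁ ()) ; (inj₂ ()) }
        ; (suc (suc (suc zero))) → mk⇔ (λ q~ → contradiction q~ ¬q~d) λ { (inj₁ ()) ; (inj₂ ()) }
        ; (suc (suc (suc (suc zero)))) → mk⇔ (λ q~ → contradiction q~ ¬q~e) λ { (inj₁ ()) ; (inj₂ ()) }
        }

  -- Minimal connectors in 𝒞

  module _ (noLongHole : ¬ HasLongHole G) (noExtendedC5 : ¬ HasExtendedC5 G)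
           {S D D′ Z : Subset n}
           (D-component : IsComponent G S D) (D′-component : IsComponent G S D′)
           (D′-full : ∀ v → (v ∈ S) ⇔ InN G D′ v) (D′≢D : D′ ≢ D)
           (Z⊆D : Z ⊆ D) (Z-connected : Connected G Z) (Z-dominates : ∀ {v} → v ∈ S → InN G Z v)
           (Z-minimal : ∀ Z′ → Z′ ⊆ Z → Admissible G S D Z′ → Z′ ≡ Z)
    where

    S∩Z=∅ : ∀ {v z} → v ∈ S → z ∈ Z → v ≢ z
    S∩Z=∅ v∈S z∈Z refl = proj₁ D-component (Z⊆D z∈Z) v∈S

    S∩D′=∅ : ∀ {v c} → v ∈ S → c ∈ D′ → v ≢ c
    S∩D′=∅ v∈S c∈D′ refl = proj₁ D′-component c∈D′ v∈S

    D′-Z-apart : ∀ {a z} → a ∈ D′ → z ∈ Z → ¬ a ~ z × a ≢ z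
    D′-Z-apart {a} a∈D′ z∈Z =
        (λ a~z → D′∩D=∅ (proj₂ (proj₂ D-component) (Z⊆D z∈Z) (proj₁ D′-component a∈D′) (~-sym a~z)))
      , (λ { refl → D′∩D=∅ (Z⊆D z∈Z) })
      where
        D′∩D=∅ : a ∉ D
        D′∩D=∅ a∈D = D′≢D (component-unique D′-component D-component a∈D′ a∈D)

    undominated-vertex : ∀ {X} → X ⊆ Z → Connected G X → X ≢ Z → ∃[ t ] t ∈ S × ¬ InN G X t
    undominated-vertex {X} X⊆Z X-connected X≢Z with any? (λ v → (v ∈? S) ×-dec ¬? (InN? X v))
    ... | yes found = found
    ... | no none   = contradiction (Z-minimal X X⊆Z ((λ x∈X → Z⊆D (X⊆Z x∈X)) , X-connected , dominates)) X≢Z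
      where
        dominates : ∀ {v} → v ∈ S → InN G X v
        dominates {v} v∈S = decidable-stable (InN? X v) (λ ¬N → none (v , v∈S , ¬N))

    private-neighbour : ∀ {b} → b ∈ Z → Connected G (Z - b) →
      ∃[ s ] s ∈ S × b ~ s × (∀ {z} → z ∈ Z → z ~ s → z ≡ b)
    private-neighbour {b} b∈Z Z-b-connected
      with s , s∈S , ¬N ← undominated-vertex (p─q⊆p Z ⁅ b ⁆) Z-b-connected
                            (λ eq → x∈p-y⇒x≢y (subst (b ∈_) (sym eq) b∈Z) refl)
      with _ , z , z∈Z , z~s ← Z-dominates s∈S
      = s , s∈S , subst (_~ s) (only-b z∈Z z~s) z~s , only-b
      where
        only-b : ∀ {z} → z ∈ Z → z ~ s → z ≡ b
        only-b {z} z∈Z z~s = decidable-stable (z ≟ b) λ z≢b →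
          ¬N ((λ s∈ → S∩Z=∅ s∈S (p─q⊆p Z ⁅ b ⁆ s∈) refl) , z , x∈p∧x≢y⇒x∈p-y z∈Z z≢b , z~s)

    far-vertex : ∀ {b y} → b ∈ Z → y ∈ Z → y ≢ b → ¬ b ~ y →
      ∃[ t ] t ∈ S × (∀ {z} → z ∈ Z → z ≡ b ⊎ b ~ z → ¬ z ~ t)
    far-vertex {b} {y} b∈Z y∈Z y≢b ¬b~y
      with t , t∈S , ¬N ← undominated-vertex (p∩q⊆p Z N[ b ]) (∩N[]-connected b∈Z)
                            (∩N[]-proper y∈Z y≢b ¬b~y)
      = t , t∈S , λ z∈Z near z~t →
          ¬N ( (λ t∈ → S∩Z=∅ t∈S (p∩q⊆p Z N[ b ] t∈) refl)
             , _ , x∈p∩q⁺ (z∈Z , Equivalence.from ∈-N[] near) , z~t)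

    D′-connected : Connected G D′
    D′-connected = proj₁ (proj₂ D′-component)

    module _ {b s t : Fin n} (b∈Z : b ∈ Z) (s∈S : s ∈ S) (t∈S : t ∈ S) (b~s : b ~ s)
             (s-private : ∀ {z} → z ∈ Z → z ~ s → z ≡ b)
             (t-far : ∀ {z} → z ∈ Z → z ≡ b ⊎ b ~ z → ¬ z ~ t)
      where

      t≢s : t ≢ s
      t≢s refl = t-far b∈Z (inj₁ refl) b~s

      s-then-path : ∀ {P} → InducedPathIn Z P → OnlyHead (s ~_) P → InducedPath (s ∷ P)
      s-then-path {_ ∷ _} (path , P⊆Z) first = cons first (All.map (S∩Z=∅ s∈S) P⊆Z) path

      hole-through-D′ : ∀ {P} → InducedPathIn Z P → OnlyHead (s ~_) P → OnlyLast (t ~_) P →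
        3 ≤ length P → ¬ s ~ t → HasLongHole G
      hole-through-D′ {P} path@(_ , P⊆Z) first last 3≤|P| ¬s~t
        with _ , uₜ , uₜ∈D′ , uₜ~t ← Equivalence.to (D′-full t) t∈S
        with _ , uₛ , uₛ∈D′ , uₛ~s ← Equivalence.to (D′-full s) s∈S
        with induced-path (E? t) (E? s) (~-sym uₜ~t) (~-sym uₛ~s) (proj₂ D′-connected uₜ∈D′ uₛ∈D′)
      ... | [] , _ , () , _
      ... | r ∷ rs , (pathR , R⊆D′) , (t~r , ¬t~rs) , lastR =
        long-hole (r ∷ rs ++ s ∷ P)
          (InducedPath-++ pathR R⊆D′ lastR (All.map (λ a∈D′ → S∩D′=∅ s∈S a∈D′ ∘ sym) R⊆D′)
            (s-then-path path first) P⊆Z D′-Z-apart)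
          (++⁺ (All.map (S∩D′=∅ t∈S) R⊆D′) (t≢s ∷ All.map (S∩Z=∅ t∈S) P⊆Z))
          (t~r , OnlyLast-++ rs ¬t~rs (OnlyLast-∷ P (¬s~t ∘ ~-sym) last))
          (s≤s (≤-trans (s≤s 3≤|P|) (length-++-≤ʳ (s ∷ P) {rs})))

      hole-through-edge : ∀ {P} → InducedPathIn Z P → OnlyHead (s ~_) P → OnlyLast (t ~_) P →
        3 ≤ length P → s ~ t → HasLongHole G ⊎ HasExtendedC5 G
      hole-through-edge {_ ∷ []}     _ _ _ (s≤s ()) _
      hole-through-edge {_ ∷ _ ∷ []} _ _ _ (s≤s (s≤s ())) _
      hole-through-edge {P@(_ ∷ _ ∷ _ ∷ [])} path@(_ , P⊆Z@(p₀∈Z ∷ p₁∈Z ∷ p₂∈Z ∷ [])) first last _ s~t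
        with _ , q , q∈D′ , q~t ← Equivalence.to (D′-full t) t∈S
        = inj₂ (extended-C5
            (induced-cycle (s ∷ P) (s-then-path path first) (t≢s ∷ All.map (S∩Z=∅ t∈S) P⊆Z) (~-sym s~t , last))
            (S∩D′=∅ t∈S q∈D′ ∘ sym ∷ S∩D′=∅ s∈S q∈D′ ∘ sym ∷ All.map (proj₂ ∘ D′-Z-apart q∈D′) P⊆Z)
            q~t (proj₁ (D′-Z-apart q∈D′ p₀∈Z)) (proj₁ (D′-Z-apart q∈D′ p₁∈Z)) (proj₁ (D′-Z-apart q∈D′ p₂∈Z)))
      hole-through-edge {P@(_ ∷ _ ∷ _ ∷ _ ∷ _)} path@(_ , P⊆Z) first last _ s~t =
        inj₁ (long-hole (s ∷ P) (s-then-path path first) (t≢s ∷ All.map (S∩Z=∅ t∈S) P⊆Z) (~-sym s~t , last)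
               (s≤s (s≤s (s≤s (s≤s (s≤s z≤n))))))

      path-contradiction : ∀ {P} → InducedPathIn Z P → OnlyHead (s ~_) P → OnlyLast (t ~_) P → ⊥
      path-contradiction {_ ∷ []} (_ , p₀∈Z ∷ []) (s~p₀ , _) t~p₀ =
        t-far p₀∈Z (inj₁ (s-private p₀∈Z (~-sym s~p₀))) (~-sym t~p₀)
      path-contradiction {_ ∷ p₁ ∷ []} (cons (p₀~p₁ , _) _ _ , p₀∈Z ∷ p₁∈Z ∷ []) (s~p₀ , _) (_ , t~p₁) =
        t-far p₁∈Z (inj₂ (subst (_~ p₁) (s-private p₀∈Z (~-sym s~p₀)) p₀~p₁)) (~-sym t~p₁)
      path-contradiction {_ ∷ _ ∷ _ ∷ _} path first last with E? s t
      ... | no ¬s~t = noLongHole (hole-through-D′ path first last (s≤s (s≤s (s≤s z≤n))) ¬s~t)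
      ... | yes s~t = Sum.[ noLongHole , noExtendedC5 ] (hole-through-edge path first last (s≤s (s≤s (s≤s z≤n))) s~t)

    no-nonadjacent-pair : ∀ {x y} → x ∈ Z → y ∈ Z → x ≢ y → ¬ x ~ y → ⊥
    no-nonadjacent-pair x∈Z y∈Z x≢y ¬x~y
      with b , b∈Z , Z-b-connected , y′ , y′∈Z , y′≢b , ¬b~y′
             ← non-cut-non-universal-vertex Z-connected x∈Z y∈Z x≢y ¬x~y
      with s , s∈S , b~s , s-private ← private-neighbour b∈Z Z-b-connected
      with t , t∈S , t-far ← far-vertex b∈Z y′∈Z y′≢b ¬b~y′
      with _ , z , z∈Z , z~t ← Z-dominates t∈S
      with P , path , first , last ← induced-path (E? s) (E? t) (~-sym b~s) (~-sym z~t) (proj₂ Z-connected b∈Z z∈Z)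
      = path-contradiction b∈Z s∈S t∈S b~s s-private t-far path first last

lemma3p2 : ∀ {n : ℕ} (G : Graph n) → InC G → (S D Z : Subset n) →
    IsMinimalSeparator G S → IsFullComponent G S D →
    MinimalAdmissible G S D Z → IsClique G Z
lemma3p2 G (noLongHole , noExtendedC5) S D Z separator (D-component , _) ((Z⊆D , Z-connected , Z-dominates) , Z-minimal)
  {u} {v} u∈Z v∈Z u≢v
  with D′ , (D′-component , D′-full) , D′≢D ← other-full-component G separator D
  with E? G u v
... | yes u~v = u~v
... | no ¬u~v = ⊥-elim (no-nonadjacent-pair G noLongHole noExtendedC5 D-component D′-component D′-full D′≢D
                          Z⊆D Z-connected Z-dominates Z-minimal u∈Z v∈Z u≢v ¬u~v)
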